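{- Consider the $p$-processor cup game on $n \ge p+1$ cups with the emptier following the greedy algorithm. Suppose that $S_t(j) > S_{t-1}(j)$ for some $j \le p$. Then $S_t(j+1), S_t(j+2), \ldots, S_t(p+1)$ are each at least $S_t(j) - 1$.
   Context: The $p$-processor cup game on $n$ cups: $n$ cups with nonnegative real fills. In each step, the filler first distributes up to $p$ units of water among the cups, placing at most $1$ unit into any single cup; then the emptier selects $p$ cups and removes up to $1$ unit of water from each. The greedy algorithm for the emptier: in each step, after the filler has placed water, remove $1$ unit of water from each of the $p$ fullest cups (removing all of a cup's water if it contains less than $1$ unit); ties broken arbitrarily. $S_t$ denotes the state after step $t$, and $S(i)$ denotes the fill of the $i$-th fullest cup in state $S$.
   Formalization: The cup fills and the amounts of water placed by the filler are rational rather than real. -}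

module Defs where

open import Data.Nat using (ℕ; zero; suc)
open import Data.Fin using (Fin)
open import Data.List using (List; []; _∷_; tabulate; reverse)
open import Data.Rational using (ℚ; 0ℚ; 1ℚ; _+_; _-_; _≤_; _⊔_)
open import Data.Rational.Properties using (≤-decTotalOrder)
open import Data.Fin.Subset using (Subset; _∈_; _∉_; ∣_∣)
open import Data.Product using (_×_)
open import Relation.Binary.PropositionalEquality using (_≡_)
import Data.List.Sort
import Data.Rational
import Data.Integer
import Data.Fin
import Data.Fin.Subset
import Data.Vec
import Data.Bool
import Data.Product

State : ℕ → Set
State n = Fin n → ℚ

Nonneg : ∀ {n} → State n → Set
Nonneg S = ∀ i → 0ℚ ≤ S i

sumℚ : ∀ {n} → (Fin n → ℚ) → ℚ
sumℚ {zero}  f = 0ℚ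
sumℚ {suc n} f = f Fin.zero + sumℚ (λ i → f (Fin.suc i))

open Data.List.Sort ≤-decTotalOrder using (sort)

nth : List ℚ → ℕ → ℚ
nth []       _       = 0ℚ
nth (x ∷ xs) zero    = x
nth (x ∷ xs) (suc k) = nth xs k

sortedDesc : ∀ {n} → State n → List ℚ
sortedDesc S = reverse (sort (tabulate S))

-- fullest S j = S(j), the fill of the j-th fullest cup (1-indexed: j = 1 is fullest)
fullest : ∀ {n} → State n → ℕ → ℚ
fullest S zero    = 0ℚ   -- unused junk value
fullest S (suc k) = nth (sortedDesc S) k

LegalFill : ∀ {n} → ℕ → (Fin n → ℚ) → Set
LegalFill p f = (∀ i → 0ℚ ≤ f i × f i ≤ 1ℚ) × sumℚ f ≤ Data.Rational._/_ (Data.Integer.+_ p) 1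

GreedyChoice : ∀ {n} → ℕ → State n → Subset n → Set
GreedyChoice p y E = (∣ E ∣ ≡ p) × (∀ i k → i ∈ E → k ∉ E → y k ≤ y i)

empty : ∀ {n} → State n → Subset n → State n
empty y E i with Data.Vec.lookup E i
... | Data.Bool.true  = 0ℚ ⊔ (y i - 1ℚ)
... | Data.Bool.false = y i

GreedyStep : ∀ {n} → ℕ → State n → State n → Set
GreedyStep {n} p S S' =
  Data.Product.Σ (Fin n → ℚ) λ f → Data.Product.Σ (Subset n) λ E →
    LegalFill p f × GreedyChoice p (λ i → S i + f i) E ×
    (∀ i → S' i ≡ empty (λ k → S k + f k) E i)

-- Let x = S₁(j).  If some cup that was not emptied ends with fill ≥ x, then
-- every emptied cup was at least as full before emptying, so those p cups and
-- this one all end with fill ≥ x − 1.  Otherwise every cup ending with fill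
-- ≥ x > 0 was emptied, and since it gained at most 1 and lost exactly 1 it
-- already had fill ≥ x before the step; the j such cups then force
-- S₀(j) ≥ x, a contradiction.  (If x ≤ 0 every cup trivially ends ≥ x − 1.)
-- So at least p + 1 cups end with fill ≥ x − 1, which bounds S₁(k) for every
-- k ≤ p + 1; order statistics are compared by counting: S(k) ≥ v iff at
-- least k cups have fill ≥ v.
module Submission where

open import Defs
open import Data.Nat using (ℕ; suc; _≤_; _<_)
open import Data.Rational using (_-_; 1ℚ)
import Data.Rational

open import Data.Nat using (zero; z≤n; s≤s)
import Data.Nat.Properties as ℕ
open import Data.Rational using (ℚ; 0ℚ; _+_; _⊔_; -_; _≥_)
import Data.Rational as ℚ
open import Data.Rational.Properties
  using (≤-refl; ≤-trans; ≤-total; ≤-decTotalOrder; <-irrefl; <-≤-trans; ≰⇒>;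
         +-monoʳ-≤; +-monoˡ-≤; +-mono-≤; +-assoc; +-inverseʳ; +-identityʳ;
         p≤q⇒p⊔q≡q; p≥q⇒p⊔q≡p; p≤p⊔q; p≤q⊔p)
open import Data.List using (List; []; _∷_; length; filter; reverse; tabulate)
open import Data.List.Properties using (filter-none; unfold-reverse; length-tabulate)
open import Data.List.Relation.Unary.All as All using (All; []; _∷_)
open import Data.List.Relation.Unary.AllPairs using (AllPairs; []; _∷_)
import Data.List.Relation.Unary.AllPairs.Properties as AllPairs
open import Data.List.Relation.Unary.Linked.Properties using (Linked⇒AllPairs)
open import Data.List.Relation.Binary.Permutation.Propositional using (_↭_; ↭-sym; ↭-trans)
open import Data.List.Relation.Binary.Permutation.Propositional.Properties
  using (All-resp-↭; ↭-reverse; ↭-length; filter-↭)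
open import Data.List.Sort ≤-decTotalOrder using (sort; sort-↭; sort-↗)
open import Data.Fin using (Fin)
import Data.Fin as Fin
open import Data.Fin.Properties using (any?)
open import Data.Fin.Subset using (Subset; _∈_; _∉_; _⊆_; ∣_∣; ⊤)
open import Data.Fin.Subset.Properties using (_∈?_; p⊆q⇒∣p∣≤∣q∣; p⊂q⇒∣p∣<∣q∣; ∣⊤∣≡n)
import Data.Vec as Vec
open import Data.Vec.Properties using (lookup∘tabulate; []=⇒lookup; lookup⇒[]=)
open import Data.Bool using (true; false)
open import Data.Product using (_,_; proj₁; proj₂)
open import Data.Sum using (inj₁; inj₂)
open import Function using (flip; _∘_)
open import Relation.Binary using (Rel)
open import Relation.Nullary
  using (¬_; yes; no; does; proof; Reflects; invert; ¬?; contradiction)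
open import Relation.Nullary.Decidable using (dec-true; toWitness; decidable-stable; _×-dec_)
open import Relation.Unary using (Pred; Decidable)
open import Relation.Binary.PropositionalEquality using (_≡_; refl; sym; trans; cong; subst)

<⇒≱ : ∀ {p q} → p ℚ.< q → ¬ q ℚ.≤ p
<⇒≱ p<q q≤p = <-irrefl refl (<-≤-trans p<q q≤p)

p-1≤p : ∀ p → p - 1ℚ ℚ.≤ p
p-1≤p p = subst (p - 1ℚ ℚ.≤_) (+-identityʳ p) (+-monoʳ-≤ p (toWitness {a? = - 1ℚ ℚ.≤? 0ℚ} _))

p+q-1≤p : ∀ p {q} → q ℚ.≤ 1ℚ → p + q - 1ℚ ℚ.≤ p
p+q-1≤p p {q} q≤1 = begin
  p + q - 1ℚ     ≤⟨ +-monoˡ-≤ (- 1ℚ) (+-monoʳ-≤ p q≤1) ⟩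
  p + 1ℚ - 1ℚ    ≡⟨ +-assoc p 1ℚ (- 1ℚ) ⟩
  p + (1ℚ - 1ℚ)  ≡⟨ cong (p +_) (+-inverseʳ 1ℚ) ⟩
  p + 0ℚ         ≡⟨ +-identityʳ p ⟩
  p              ∎
  where open Data.Rational.Properties.≤-Reasoning

0<p≤0⊔q⇒p≤q : ∀ {p q} → 0ℚ ℚ.< p → p ℚ.≤ 0ℚ ⊔ q → p ℚ.≤ q
0<p≤0⊔q⇒p≤q {p} {q} 0<p p≤0⊔q with ≤-total 0ℚ q
... | inj₁ 0≤q = subst (p ℚ.≤_) (p≤q⇒p⊔q≡q 0≤q) p≤0⊔q
... | inj₂ q≤0 = contradiction (subst (p ℚ.≤_) (p≥q⇒p⊔q≡p q≤0) p≤0⊔q) (<⇒≱ 0<p)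

AllPairs-reverse⁺ : ∀ {a ℓ} {A : Set a} {R : Rel A ℓ} {xs : List A} →
  AllPairs R xs → AllPairs (flip R) (reverse xs)
AllPairs-reverse⁺ [] = []
AllPairs-reverse⁺ {xs = x ∷ xs} (Rx ∷ Rxs) rewrite unfold-reverse x xs =
  AllPairs.++⁺ (AllPairs-reverse⁺ Rxs) ([] ∷ [])
    (All.map (_∷ []) (All-resp-↭ (↭-sym (↭-reverse xs)) Rx))

Descending : List ℚ → Set
Descending = AllPairs _≥_

All-nth : ∀ {ℓ} {P : Pred ℚ ℓ} {xs} i → All P xs → i < length xs → P (nth xs i)
All-nth zero    (px ∷ _)   _         = px
All-nth (suc i) (_ ∷ pxs) (s≤s i<n) = All-nth i pxs i<n

UpwardClosed : ∀ {ℓ} → Pred ℚ ℓ → Set ℓ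
UpwardClosed P = ∀ {a b} → a ℚ.≤ b → P a → P b

module _ {ℓ} {P : Pred ℚ ℓ} (P? : Decidable P) (P↑ : UpwardClosed P) where

  i<count⇒nth∈P : ∀ {D} i → Descending D → i < length (filter P? D) → P (nth D i)
  i<count⇒nth∈P {d ∷ D} i (d≥D ∷ D↓) i<count with P? d
  i<count⇒nth∈P zero    _        _             | yes Pd = Pd
  i<count⇒nth∈P (suc i) (_ ∷ D↓) (s≤s i<count) | yes _  = i<count⇒nth∈P i D↓ i<count
  i<count⇒nth∈P {d ∷ D} i (d≥D ∷ _) i<count    | no ¬Pd =
    contradiction (subst (i <_) (cong length (filter-none P? ¬PD)) i<count) ℕ.n≮0
    where
    ¬PD : All (¬_ ∘ P) D
    ¬PD = All.map (λ w≤d Pw → ¬Pd (P↑ w≤d Pw)) d≥D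

  nth∈P⇒i<count : ∀ {D} i → Descending D → i < length D → P (nth D i) →
    i < length (filter P? D)
  nth∈P⇒i<count {d ∷ D} i (d≥D ∷ D↓) i<n Pnth with P? d
  nth∈P⇒i<count zero    _         _         _    | yes _  = s≤s z≤n
  nth∈P⇒i<count (suc i) (_ ∷ D↓)  (s≤s i<n) Pnth | yes _  = s≤s (nth∈P⇒i<count i D↓ i<n Pnth)
  nth∈P⇒i<count zero    _         _         Pd   | no ¬Pd = contradiction Pd ¬Pd
  nth∈P⇒i<count (suc i) (d≥D ∷ _) (s≤s i<n) Pnth | no ¬Pd =
    contradiction (P↑ (All-nth i d≥D i<n) Pnth) ¬Pd

length-filter-tabulate : ∀ {a ℓ n} {A : Set a} {P : Pred A ℓ} (P? : Decidable P) (f : Fin n → A) →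
  length (filter P? (tabulate f)) ≡ ∣ Vec.tabulate (λ i → does (P? (f i))) ∣
length-filter-tabulate {n = zero}  P? f = refl
length-filter-tabulate {n = suc n} P? f with P? (f Fin.zero)
... | yes _ = cong suc (length-filter-tabulate P? (f ∘ Fin.suc))
... | no _  = length-filter-tabulate P? (f ∘ Fin.suc)

atLeast : ∀ {n} → ℚ → State n → Subset n
atLeast v S = Vec.tabulate (λ i → does (v ℚ.≤? S i))

module _ {n} (S : State n) {v : ℚ} where

  ∈-atLeast⁺ : ∀ {i} → v ℚ.≤ S i → i ∈ atLeast v S
  ∈-atLeast⁺ {i} v≤Si =
    lookup⇒[]= i _ (trans (lookup∘tabulate _ i) (dec-true (v ℚ.≤? S i) v≤Si))

  ∈-atLeast⁻ : ∀ {i} → i ∈ atLeast v S → v ℚ.≤ S i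
  ∈-atLeast⁻ {i} i∈ = invert (subst (Reflects (v ℚ.≤ S i)) does≡true (proof (v ℚ.≤? S i)))
    where
    does≡true : does (v ℚ.≤? S i) ≡ true
    does≡true = trans (sym (lookup∘tabulate _ i)) ([]=⇒lookup i∈)

  n≤∣atLeast∣ : (∀ i → v ℚ.≤ S i) → n ≤ ∣ atLeast v S ∣
  n≤∣atLeast∣ v≤S = subst (_≤ ∣ atLeast v S ∣) (∣⊤∣≡n n)
    (p⊆q⇒∣p∣≤∣q∣ {p = ⊤} (λ {i} _ → ∈-atLeast⁺ (v≤S i)))

sortedDesc-↭ : ∀ {n} (S : State n) → sortedDesc S ↭ tabulate S
sortedDesc-↭ S = ↭-trans (↭-reverse _) (sort-↭ (tabulate S))

sortedDesc-descending : ∀ {n} (S : State n) → Descending (sortedDesc S)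
sortedDesc-descending S = AllPairs-reverse⁺ (Linked⇒AllPairs ≤-trans (sort-↗ (tabulate S)))

length-sortedDesc : ∀ {n} (S : State n) → length (sortedDesc S) ≡ n
length-sortedDesc S = trans (↭-length (sortedDesc-↭ S)) (length-tabulate S)

count-sortedDesc : ∀ {n} (S : State n) v →
  length (filter (v ℚ.≤?_) (sortedDesc S)) ≡ ∣ atLeast v S ∣
count-sortedDesc S v = trans (↭-length (filter-↭ (v ℚ.≤?_) (sortedDesc-↭ S)))
                             (length-filter-tabulate (v ℚ.≤?_) S)

i<∣atLeast∣⇒≤fullest : ∀ {n} (S : State n) {v} i → i < ∣ atLeast v S ∣ → v ℚ.≤ fullest S (suc i)
i<∣atLeast∣⇒≤fullest S {v} i i<count =
  i<count⇒nth∈P (v ℚ.≤?_) (flip ≤-trans) i (sortedDesc-descending S)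
    (subst (i <_) (sym (count-sortedDesc S v)) i<count)

i<∣atLeast-fullest∣ : ∀ {n} (S : State n) i → i < n → i < ∣ atLeast (fullest S (suc i)) S ∣
i<∣atLeast-fullest∣ S i i<n = subst (i <_) (count-sortedDesc S _)
  (nth∈P⇒i<count (fullest S (suc i) ℚ.≤?_) (flip ≤-trans) i (sortedDesc-descending S)
    (subst (i <_) (sym (length-sortedDesc S)) i<n) ≤-refl)

empty-∈ : ∀ {n} (y : State n) {E : Subset n} {i} → i ∈ E → empty y E i ≡ 0ℚ ⊔ (y i - 1ℚ)
empty-∈ y {E} {i} i∈E rewrite []=⇒lookup i∈E = refl

empty-∉ : ∀ {n} (y : State n) {E : Subset n} {i} → i ∉ E → empty y E i ≡ y i
empty-∉ y {E} {i} i∉E with Vec.lookup E i in lookup≡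
... | true  = contradiction (lookup⇒[]= i E lookup≡) i∉E
... | false = refl

module Emptying {n} (S₀ f : State n) {S₁ : State n} {E : Subset n}
                (S₁≡ : ∀ i → S₁ i ≡ empty (λ i → S₀ i + f i) E i) where

  emptied-∈ : ∀ {i} → i ∈ E → S₁ i ≡ 0ℚ ⊔ (S₀ i + f i - 1ℚ)
  emptied-∈ {i} i∈E = trans (S₁≡ i) (empty-∈ (λ i → S₀ i + f i) i∈E)

  emptied-∉ : ∀ {i} → i ∉ E → S₁ i ≡ S₀ i + f i
  emptied-∉ {i} i∉E = trans (S₁≡ i) (empty-∉ (λ i → S₀ i + f i) i∉E)

  emptied-nonneg : Nonneg S₀ → Nonneg f → Nonneg S₁
  emptied-nonneg S₀≥0 f≥0 i with i ∈? E
  ... | yes i∈E = subst (0ℚ ℚ.≤_) (sym (emptied-∈ i∈E)) (p≤p⊔q 0ℚ (S₀ i + f i - 1ℚ))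
  ... | no i∉E  = subst (0ℚ ℚ.≤_) (sym (emptied-∉ i∉E)) (+-mono-≤ (S₀≥0 i) (f≥0 i))

  unemptied-≥⇒p<∣atLeast∣ : ∀ {p c v} → GreedyChoice p (λ i → S₀ i + f i) E →
    c ∉ E → v ℚ.≤ S₁ c → p < ∣ atLeast (v - 1ℚ) S₁ ∣
  unemptied-≥⇒p<∣atLeast∣ {c = c} {v} (∣E∣≡p , chosen≥unchosen) c∉E v≤S₁c =
    subst (_< ∣ atLeast (v - 1ℚ) S₁ ∣) ∣E∣≡p
      (p⊂q⇒∣p∣<∣q∣ (E⊆ , c , ∈-atLeast⁺ S₁ (≤-trans (p-1≤p v) v≤S₁c) , c∉E))
    where
    v≤yc : v ℚ.≤ S₀ c + f c
    v≤yc = subst (v ℚ.≤_) (emptied-∉ c∉E) v≤S₁c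
    E⊆ : E ⊆ atLeast (v - 1ℚ) S₁
    E⊆ {i} i∈E = ∈-atLeast⁺ S₁ (subst (v - 1ℚ ℚ.≤_) (sym (emptied-∈ i∈E))
      (≤-trans (+-monoˡ-≤ (- 1ℚ) (≤-trans v≤yc (chosen≥unchosen i c i∈E c∉E))) (p≤q⊔p 0ℚ _)))

  all-emptied⇒atLeast-⊆ : ∀ {v} → (∀ i → f i ℚ.≤ 1ℚ) → 0ℚ ℚ.< v →
    (∀ i → v ℚ.≤ S₁ i → i ∈ E) → atLeast v S₁ ⊆ atLeast v S₀
  all-emptied⇒atLeast-⊆ {v} f≤1 0<v emptied {i} i∈ =
    ∈-atLeast⁺ S₀ (≤-trans v≤yi-1 (p+q-1≤p (S₀ i) (f≤1 i)))
    where
    v≤S₁i : v ℚ.≤ S₁ i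
    v≤S₁i = ∈-atLeast⁻ S₁ i∈
    v≤yi-1 : v ℚ.≤ S₀ i + f i - 1ℚ
    v≤yi-1 = 0<p≤0⊔q⇒p≤q 0<v (subst (v ℚ.≤_) (emptied-∈ (emptied i v≤S₁i)) v≤S₁i)

lemma4p7 : (p n : ℕ) → suc p ≤ n → (S₀ S₁ : State n) → Nonneg S₀ → GreedyStep p S₀ S₁ →
    (j : ℕ) → 1 ≤ j → j ≤ p → fullest S₀ j Data.Rational.< fullest S₁ j →
    (k : ℕ) → j < k → k ≤ suc p → fullest S₁ j - 1ℚ Data.Rational.≤ fullest S₁ k
lemma4p7 p n p<n S₀ S₁ S₀≥0 (f , E , (f∈[0,1] , _) , greedy , S₁≡)
         (suc j) _ j<p S₀j<x (suc k) _ k<p+1 =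
  i<∣atLeast∣⇒≤fullest S₁ k (ℕ.<-≤-trans k<p+1 p<∣atLeast∣)
  where
  open Emptying S₀ f {E = E} S₁≡
  x : ℚ
  x = fullest S₁ (suc j)
  p<∣atLeast∣ : p < ∣ atLeast (x - 1ℚ) S₁ ∣
  p<∣atLeast∣ with any? (λ c → ¬? (c ∈? E) ×-dec x ℚ.≤? S₁ c) | x ℚ.≤? 0ℚ
  ... | yes (c , c∉E , x≤S₁c) | _ = unemptied-≥⇒p<∣atLeast∣ greedy c∉E x≤S₁c
  ... | no _ | yes x≤0 = ℕ.<-≤-trans p<n (n≤∣atLeast∣ S₁ λ i →
          ≤-trans (≤-trans (p-1≤p x) x≤0) (emptied-nonneg S₀≥0 (proj₁ ∘ f∈[0,1]) i))
  ... | no none | no x≰0 = contradiction x≤S₀j (<⇒≱ S₀j<x)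
    where
    j<n : j < n
    j<n = ℕ.<-trans j<p p<n
    ∣atLeast₁∣≤∣atLeast₀∣ : ∣ atLeast x S₁ ∣ ≤ ∣ atLeast x S₀ ∣
    ∣atLeast₁∣≤∣atLeast₀∣ = p⊆q⇒∣p∣≤∣q∣ (all-emptied⇒atLeast-⊆ (proj₂ ∘ f∈[0,1]) (≰⇒> x≰0)
      λ c x≤S₁c → decidable-stable (c ∈? E) λ c∉E → none (c , c∉E , x≤S₁c))
    x≤S₀j : x ℚ.≤ fullest S₀ (suc j)
    x≤S₀j = i<∣atLeast∣⇒≤fullest S₀ j
      (ℕ.<-≤-trans (i<∣atLeast-fullest∣ S₁ j j<n) ∣atLeast₁∣≤∣atLeast₀∣)
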